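{- Let $(M,\gamma,r,k)$ be an instance of FDMC with $M\in\{0,1\}^{m\times n}$ such that $2\,\mathrm{tw}(M)+2\le\tilde{c}$. Then $(M,\gamma,r,k)$ is a YES-instance if and only if $k$ is at least the number of non-zero entries of $M$.
   Context: An instance of \textsc{Fair Discrete Means Cluster Editing} (FDMC) consists of an $m\times n$ matrix $M$, a vector $\gamma\in[c]^m$ (the color of row $i$ is $\gamma[i]$), and positive integers $k$ and $r$. A cluster of a matrix is a maximal set of pairwise identical rows. For a color $i\in[c]$ let $|\gamma|_i$ be the number of entries of $\gamma$ equal to $i$. A matrix $M'$ with $m$ rows is fair (w.r.t. $\gamma$) if every cluster $S$ of $M'$ contains exactly $\frac{|\gamma|_i}{m}|S|$ rows of color $i$, for every $i\in[c]$. The instance is a YES-instance if there exists a fair $m\times n$ matrix $M'$ differing from $M$ in at most $k$ entries with at most $r$ distinct rows. The fairlet size is $\tilde{c}=m/\gcd(|\gamma|_1,\dots,|\gamma|_c)$. For $M\in\{0,1\}^{m\times n}$, the primal graph of $M$ has vertices $v_1,\dots,v_m$ (one per row) and an edge $v_hv_i$ ($h\neq i$) iff there is a column $j$ with $M[h,j]\neq0$ and $M[i,j]\neq0$; $\mathrm{tw}(M)$ is the treewidth of the primal graph. -}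

module Defs where

open import Data.Nat using (ℕ; zero; suc; _+_; _*_; _≤_; _<_)
open import Data.Nat.DivMod using (_/_)
open import Data.Nat.GCD using (gcd)
open import Data.Bool using (Bool; true; false; if_then_else_)
open import Data.Fin using (Fin; zero; suc; toℕ)
open import Data.Fin.Subset using (Subset; ∣_∣) renaming (_∈_ to _∈ₛ_)
open import Data.Fin.Properties using (all?)
open import Data.Product using (Σ; ∃; _×_; _,_)
open import Data.Sum using (_⊎_)
open import Relation.Nullary using (¬_; ¬?; Dec; yes; no; does; _×-dec_)
open import Relation.Binary.PropositionalEquality using (_≡_; _≢_)
import Data.Nat as N
import Data.Fin as F

Matrix : ℕ → ℕ → Set
Matrix m n = Fin m → Fin n → ℕ

Binary : ∀ {m n} → Matrix m n → Set
Binary M = ∀ i j → (M i j ≡ 0) ⊎ (M i j ≡ 1)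

countB : ∀ {m} → (Fin m → Bool) → ℕ
countB {zero}  f = 0
countB {suc m} f = (if f zero then 1 else 0) + countB (λ i → f (suc i))

countB₂ : ∀ {m n} → (Fin m → Fin n → Bool) → ℕ
countB₂ {m} f = sumF (λ i → countB (f i))
  where
  sumF : ∀ {k} → (Fin k → ℕ) → ℕ
  sumF {zero}  g = 0
  sumF {suc k} g = g zero + sumF (λ i → g (suc i))

RowEq : ∀ {m n} → Matrix m n → Fin m → Fin m → Set
RowEq M h i = ∀ j → M h j ≡ M i j

rowEq? : ∀ {m n} (M : Matrix m n) h i → Dec (RowEq M h i)
rowEq? M h i = all? (λ j → M h j N.≟ M i j)

colourCount : ∀ {m c} → (Fin m → Fin c) → Fin c → ℕ
colourCount γ i = countB (λ h → does (γ h F.≟ i))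

gcdAll : ∀ {c} → (Fin c → ℕ) → ℕ
gcdAll {zero}  f = 0
gcdAll {suc c} f = gcd (f zero) (gcdAll (λ i → f (suc i)))

-- fairlet size  c̃ = m / gcd(|γ|_1, …, |γ|_c)
-- (the gcd is 0 only if m = 0, where c̃ is undefined; we then set c̃ = 0)
fairletSize : ∀ {m c} → (Fin m → Fin c) → ℕ
fairletSize {m} γ with gcdAll (colourCount γ)
... | zero  = 0
... | suc g = m / suc g

-- The cluster of row h in M' is the (maximal) set of rows
-- identical to row h; every cluster arises this way.  The condition
-- |S ∩ colour i| = (|γ|_i / m) |S| is stated with denominators cleared.

clusterSize : ∀ {m n} → Matrix m n → Fin m → ℕ
clusterSize M' h = countB (λ h' → does (rowEq? M' h' h))

clusterColourSize : ∀ {m n c} → Matrix m n → (Fin m → Fin c) → Fin m → Fin c → ℕ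
clusterColourSize M' γ h i = countB (λ h' → does (rowEq? M' h' h ×-dec (γ h' F.≟ i)))

Fair : ∀ {m n c} → Matrix m n → (Fin m → Fin c) → Set
Fair {m} M' γ = ∀ (h : Fin m) (i : _) →
  m * clusterColourSize M' γ h i ≡ colourCount γ i * clusterSize M' h

distinctRows : ∀ {m n} → Matrix m n → ℕ
distinctRows {m} M' =
  countB (λ h → does (all? (λ (h' : Fin m) → ¬? (h' F.<? h ×-dec rowEq? M' h' h))))

distance : ∀ {m n} → Matrix m n → Matrix m n → ℕ
distance M M' = countB₂ (λ i j → does (¬? (M i j N.≟ M' i j)))

nonZeros : ∀ {m n} → Matrix m n → ℕ
nonZeros M = countB₂ (λ i j → does (¬? (M i j N.≟ 0)))

YesFDMC : ∀ {m n c} → Matrix m n → (Fin m → Fin c) → ℕ → ℕ → Set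
YesFDMC {m} {n} M γ r k =
  Σ (Matrix m n) λ M' → Fair M' γ × distance M M' ≤ k × distinctRows M' ≤ r

PrimalEdge : ∀ {m n} → Matrix m n → Fin m → Fin m → Set
PrimalEdge M h i = h ≢ i × ∃ λ j → M h j ≢ 0 × M i j ≢ 0

-- A tree on the nodes Fin (suc t) is given by a parent array: node
-- (suc x) has a parent with index ≤ x (every finite tree can be so
-- labelled, and every such array describes a tree).

data WalkIn {V : Set} (Adj : V → V → Set) (S : V → Set) : V → V → Set where
  here : ∀ {a} → S a → WalkIn Adj S a a
  step : ∀ {a b c} → S a → Adj a b → WalkIn Adj S b c → WalkIn Adj S a c

record TreeDecomposition {m : ℕ} (E : Fin m → Fin m → Set) (w : ℕ) : Set where
  field
    t        : ℕ
    parent   : Fin t → Fin (suc t)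
    parent<  : ∀ x → toℕ (parent x) ≤ toℕ x
    bag      : Fin (suc t) → Subset m

  TreeAdj : Fin (suc t) → Fin (suc t) → Set
  TreeAdj a b = (∃ λ x → a ≡ suc x × b ≡ parent x) ⊎ (∃ λ x → b ≡ suc x × a ≡ parent x)

  field
    bagSize   : ∀ x → ∣ bag x ∣ ≤ suc w
    vertexIn  : ∀ v → ∃ λ x → v ∈ₛ bag x
    edgeIn    : ∀ u v → E u v → ∃ λ x → u ∈ₛ bag x × v ∈ₛ bag x
    connected : ∀ v a b → v ∈ₛ bag a → v ∈ₛ bag b →
                WalkIn TreeAdj (λ x → v ∈ₛ bag x) a b

TreewidthAtMost : ∀ {m n} → Matrix m n → ℕ → Set
TreewidthAtMost M w = TreeDecomposition (PrimalEdge M) w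

-- Fairness forces every cluster of a solution to have at least c̃ rows, since m divides
-- |γ|ᵢ |S| for every colour i and hence gcd |γ|ᵢ · |S|.  The ones of a column form a clique
-- of the primal graph, so by the Helly property of subtrees they lie in a common bag and
-- there are at most tw + 1 of them.  If one of them survives in a solution, its cluster
-- has at least 2 tw + 2 ≥ tw + 1 + (number of ones) rows that agree in that column, and all
-- those rows that had a zero there were changed; otherwise every one was changed.  So
-- every column costs at least its number of ones.  Conversely the zero matrix is fair,
-- has a single cluster, and costs exactly the number of non-zero entries.
module Submission where

open import Defs
open import Data.Bool using (Bool; true; false; T; _∧_; not; if_then_else_)
open import Data.Bool.Properties using (T-∧; not-involutive)
open import Data.Fin using (Fin; zero; suc; toℕ)
import Data.Fin as F
open import Data.Fin.Properties using (any?; all?)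
open import Data.Fin.Subset using (Subset; ∣_∣; ⁅_⁆) renaming (_∈_ to _∈ₛ_)
open import Data.Fin.Subset.Properties using (_∈?_; p⊆q⇒∣p∣≤∣q∣; ∣⁅x⁆∣≡1; x∈⁅x⁆; x∈⁅y⁆⇒x≡y)
open import Data.Nat using (ℕ; zero; suc; _+_; _*_; _≤_; _≤?_; z≤n; s≤s; _/_)
open import Data.Nat.Divisibility using (_∣_; divides; _∣0; ∣⇒≤)
open import Data.Nat.DivMod using (/-monoˡ-≤; m*n/n≡m)
open import Data.Nat.GCD using (gcd; gcd-greatest; c*gcd[m,n]≡gcd[cm,cn])
open import Data.Nat.Properties
open import Data.Nat.Tactic.RingSolver using (solve-∀)
open import Algebra.Properties.CommutativeMonoid.Sum +-0-commutativeMonoid using (∑-comm; sum-cong-≗; sum-syntax)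
open import Data.Product using (∃; _×_; _,_; proj₁; proj₂)
open import Data.Sum using (_⊎_; inj₁; inj₂)
open import Data.Unit using (tt)
open import Data.Vec using (tabulate)
open import Data.Vec.Properties using (lookup∘tabulate; []=⇒lookup; lookup⇒[]=)
open import Data.Vec.Functional using (Vector)
open import Function using (_∘_; _⇔_; mk⇔; Equivalence)
open import Relation.Nullary using (¬_; ¬?; Dec; yes; no; does; _×-dec_; contradiction; T?)
open import Relation.Nullary.Decidable using (dec-true)
open import Relation.Unary using (Decidable)
open import Relation.Binary.PropositionalEquality

T-does⁻ : ∀ {p} {P : Set p} (d : Dec P) → T (does d) → P
T-does⁻ (yes p) _ = p

T-does⁺ : ∀ {p} {P : Set p} (d : Dec P) → P → T (does d)
T-does⁺ (yes _) _  = tt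
T-does⁺ (no ¬p) p = ¬p p

countB-cong : ∀ {m} {f g : Fin m → Bool} → (∀ i → f i ≡ g i) → countB f ≡ countB g
countB-cong {zero}  f≗g = refl
countB-cong {suc m} f≗g = cong₂ _+_ (cong (λ b → if b then 1 else 0) (f≗g zero)) (countB-cong (f≗g ∘ suc))

countB-true : ∀ m → countB {m} (λ _ → true) ≡ m
countB-true zero    = refl
countB-true (suc m) = cong suc (countB-true m)

countB-split : ∀ {m} (f g : Fin m → Bool) →
               countB f ≡ countB (λ i → f i ∧ g i) + countB (λ i → f i ∧ not (g i))
countB-split {zero}  f g = refl
countB-split {suc m} f g with f zero | g zero | countB-split (f ∘ suc) (g ∘ suc)
... | false | _     | ih = ih
... | true  | true  | ih = cong suc ih
... | true  | false | ih = trans (cong suc ih) (sym (+-suc _ _))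

countB≡∣tabulate∣ : ∀ {m} (f : Fin m → Bool) → countB f ≡ ∣ tabulate f ∣
countB≡∣tabulate∣ {zero}  f = refl
countB≡∣tabulate∣ {suc m} f with f zero | countB≡∣tabulate∣ (f ∘ suc)
... | true  | ih = cong suc ih
... | false | ih = ih

∈-tabulate⁺ : ∀ {m} {f : Fin m → Bool} {i} → T (f i) → i ∈ₛ tabulate f
∈-tabulate⁺ {f = f} {i} fi with f i in eq
... | true = lookup⇒[]= i (tabulate f) (trans (lookup∘tabulate f i) eq)

∈-tabulate⁻ : ∀ {m} {f : Fin m → Bool} {i} → i ∈ₛ tabulate f → T (f i)
∈-tabulate⁻ {f = f} {i} i∈f rewrite sym (lookup∘tabulate f i) | []=⇒lookup i∈f = tt

countB≤∣_∣ : ∀ {m} {f : Fin m → Bool} (p : Subset m) → (∀ i → T (f i) → i ∈ₛ p) → countB f ≤ ∣ p ∣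
countB≤∣_∣ {f = f} p f⊆p = begin
  countB f         ≡⟨ countB≡∣tabulate∣ f ⟩
  ∣ tabulate f ∣   ≤⟨ p⊆q⇒∣p∣≤∣q∣ (λ i∈f → f⊆p _ (∈-tabulate⁻ i∈f)) ⟩
  ∣ p ∣            ∎
  where open ≤-Reasoning

countB-mono : ∀ {m} (f g : Fin m → Bool) → (∀ i → T (f i) → T (g i)) → countB f ≤ countB g
countB-mono f g f⇒g = begin
  _                ≤⟨ countB≤∣ tabulate g ∣ (λ i → ∈-tabulate⁺ ∘ f⇒g i) ⟩
  ∣ tabulate g ∣   ≡⟨ countB≡∣tabulate∣ g ⟨
  countB g         ∎
  where open ≤-Reasoning

countB-pos : ∀ {m} {f : Fin m → Bool} i → T (f i) → 1 ≤ countB f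
countB-pos {f = f} i fi = begin
  1            ≡⟨ ∣⁅x⁆∣≡1 i ⟨
  ∣ ⁅ i ⁆ ∣    ≤⟨ p⊆q⇒∣p∣≤∣q∣ (λ j∈i → subst (_∈ₛ tabulate f) (sym (x∈⁅y⁆⇒x≡y i j∈i)) (∈-tabulate⁺ fi)) ⟩
  ∣ tabulate f ∣ ≡⟨ countB≡∣tabulate∣ f ⟨
  countB f     ∎
  where open ≤-Reasoning

countB≡∑ : ∀ {m} (f : Fin m → Bool) → countB f ≡ ∑[ i < m ] (if f i then 1 else 0)
countB≡∑ {zero}  f = refl
countB≡∑ {suc m} f = cong ((if f zero then 1 else 0) +_) (countB≡∑ (f ∘ suc))

countB₂≡∑countB : ∀ {m n} (f : Fin m → Fin n → Bool) → countB₂ f ≡ ∑[ i < m ] countB (f i)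
countB₂≡∑countB {zero}  f = refl
countB₂≡∑countB {suc m} f = cong (countB (f zero) +_) (countB₂≡∑countB (f ∘ suc))

countB₂-transpose : ∀ {m n} (f : Fin m → Fin n → Bool) → countB₂ f ≡ countB₂ (λ j i → f i j)
countB₂-transpose {m} {n} f = begin
  countB₂ f                                            ≡⟨ countB₂≡∑countB f ⟩
  ∑[ i < m ] countB (f i)                              ≡⟨ sum-cong-≗ (countB≡∑ ∘ f) ⟩
  ∑[ i < m ] ∑[ j < n ] (if f i j then 1 else 0)       ≡⟨ ∑-comm (λ i j → if f i j then 1 else 0) ⟩
  ∑[ j < n ] ∑[ i < m ] (if f i j then 1 else 0)       ≡⟨ sum-cong-≗ (λ j → countB≡∑ (λ i → f i j)) ⟨
  ∑[ j < n ] countB (λ i → f i j)                      ≡⟨ countB₂≡∑countB (λ j i → f i j) ⟨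
  countB₂ (λ j i → f i j)                              ∎
  where open ≡-Reasoning

∑-mono-≤ : ∀ {n} {f g : Vector ℕ n} → (∀ i → f i ≤ g i) → ∑[ i < n ] f i ≤ ∑[ i < n ] g i
∑-mono-≤ {zero}  f≤g = z≤n
∑-mono-≤ {suc n} f≤g = +-mono-≤ (f≤g zero) (∑-mono-≤ (f≤g ∘ suc))

countB₂-mono-columnwise : ∀ {m n} {f g : Fin m → Fin n → Bool} →
                          (∀ j → countB (λ i → f i j) ≤ countB (λ i → g i j)) → countB₂ f ≤ countB₂ g
countB₂-mono-columnwise {n = n} {f} {g} f≤g = begin
  countB₂ f                    ≡⟨ countB₂-transpose f ⟩
  countB₂ (λ j i → f i j)      ≡⟨ countB₂≡∑countB (λ j i → f i j) ⟩
  ∑[ j < n ] countB (λ i → f i j) ≤⟨ ∑-mono-≤ f≤g ⟩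
  ∑[ j < n ] countB (λ i → g i j) ≡⟨ countB₂≡∑countB (λ j i → g i j) ⟨
  countB₂ (λ j i → g i j)      ≡⟨ countB₂-transpose g ⟨
  countB₂ g                    ∎
  where open ≤-Reasoning

∣-gcdAll : ∀ {c d} (f : Fin c → ℕ) → (∀ i → d ∣ f i) → d ∣ gcdAll f
∣-gcdAll {zero}  {d} f d∣f = d ∣0
∣-gcdAll {suc c}     f d∣f = gcd-greatest (d∣f zero) (∣-gcdAll (f ∘ suc) (d∣f ∘ suc))

gcdAll-*ʳ : ∀ {c} (f : Fin c → ℕ) s → gcdAll f * s ≡ gcdAll (λ i → f i * s)
gcdAll-*ʳ {zero}  f s = refl
gcdAll-*ʳ {suc c} f s = begin
  gcd (f zero) G * s            ≡⟨ *-comm (gcd (f zero) G) s ⟩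
  s * gcd (f zero) G            ≡⟨ c*gcd[m,n]≡gcd[cm,cn] s (f zero) G ⟩
  gcd (s * f zero) (s * G)      ≡⟨ cong₂ gcd (*-comm s (f zero)) (trans (*-comm s G) (gcdAll-*ʳ (f ∘ suc) s)) ⟩
  gcd (f zero * s) (gcdAll (λ i → f (suc i) * s)) ∎
  where
  G = gcdAll (f ∘ suc)
  open ≡-Reasoning

m∣gcdAll*clusterSize : ∀ {m n c} (M' : Matrix m n) (γ : Fin m → Fin c) → Fair M' γ →
                       ∀ h → m ∣ gcdAll (colourCount γ) * clusterSize M' h
m∣gcdAll*clusterSize {m} M' γ fair h =
  subst (m ∣_) (sym (gcdAll-*ʳ (colourCount γ) (clusterSize M' h)))
    (∣-gcdAll _ λ i → divides (clusterColourSize M' γ h i) (trans (sym (fair h i)) (*-comm m _)))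

/-≤-of-∣* : ∀ {m} g s → 1 ≤ s → m ∣ suc g * s → m / suc g ≤ s
/-≤-of-∣* {m} g (suc s) _ m∣gs = begin
  m / suc g                 ≤⟨ /-monoˡ-≤ (suc g) (∣⇒≤ m∣gs) ⟩
  suc g * suc s / suc g     ≡⟨ cong (_/ suc g) (*-comm (suc g) (suc s)) ⟩
  suc s * suc g / suc g     ≡⟨ m*n/n≡m (suc s) (suc g) ⟩
  suc s                     ∎
  where open ≤-Reasoning

fairletSize≤clusterSize : ∀ {m n c} (M' : Matrix m n) (γ : Fin m → Fin c) → Fair M' γ →
                          ∀ h → fairletSize γ ≤ clusterSize M' h
fairletSize≤clusterSize M' γ fair h
  with gcdAll (colourCount γ) | m∣gcdAll*clusterSize M' γ fair h
... | zero  | _      = z≤n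
... | suc g | m∣gs   = /-≤-of-∣* g _ (countB-pos h (T-does⁺ (rowEq? M' h h) λ _ → refl)) m∣gs

least : ∀ {n} {P : Fin n → Set} → Decidable P → ∀ {i} → P i →
        ∃ λ l → P l × (∀ j → P j → l F.≤ j)
least {suc n} P? {i} Pi with P? zero
... | yes P0 = zero , P0 , λ _ _ → z≤n
least {suc n} P? {zero}  P0 | no ¬P0 = contradiction P0 ¬P0
least {suc n} P? {suc i} Pi | no ¬P0 with least (P? ∘ suc) Pi
... | l , Pl , l≤ = suc l , Pl , λ { zero P0 → contradiction P0 ¬P0 ; (suc j) Pj → s≤s (l≤ j Pj) }

argmax : ∀ {n} {P : Fin n → Set} → Decidable P → (f : Fin n → ℕ) →
         (∀ i → ¬ P i) ⊎ (∃ λ i → P i × (∀ j → P j → f j ≤ f i))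
argmax {zero}  P? f = inj₁ λ ()
argmax {suc n} P? f with argmax (P? ∘ suc) (f ∘ suc) | P? zero
... | inj₁ none | no ¬P0 = inj₁ λ { zero → ¬P0 ; (suc i) → none i }
... | inj₁ none | yes P0 =
  inj₂ (zero , P0 , λ { zero _ → ≤-refl ; (suc j) Pj → contradiction Pj (none j) })
... | inj₂ (i , Pi , max) | no ¬P0 =
  inj₂ (suc i , Pi , λ { zero P0 → contradiction P0 ¬P0 ; (suc j) → max j })
... | inj₂ (i , Pi , max) | yes P0 with f zero ≤? f (suc i)
...   | yes f0≤fi = inj₂ (suc i , Pi , λ { zero _ → f0≤fi ; (suc j) → max j })
...   | no  f0≰fi = inj₂ (zero , P0 , λ { zero _ → ≤-refl ; (suc j) Pj → ≤-trans (max j Pj) (≰⇒≥ f0≰fi) })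

module TreeDecompositionProperties {m} {E : Fin m → Fin m → Set} {w} (TD : TreeDecomposition E w) where
  open TreeDecomposition TD

  Node : Set
  Node = Fin (suc t)

  -- x ≼ y: x lies on the path from y to the root, which is node 0 of the parent array
  infix 4 _≼_
  data _≼_ : Node → Node → Set where
    ≼-refl   : ∀ {x} → x ≼ x
    ≼-parent : ∀ {x z} → x ≼ parent z → x ≼ suc z

  ≼-trans : ∀ {x y z} → x ≼ y → y ≼ z → x ≼ z
  ≼-trans x≼y ≼-refl         = x≼y
  ≼-trans x≼y (≼-parent y≼z) = ≼-parent (≼-trans x≼y y≼z)

  ≼⇒≤ : ∀ {x y} → x ≼ y → x F.≤ y
  ≼⇒≤ ≼-refl                   = ≤-refl
  ≼⇒≤ (≼-parent {z = z} x≼pz) = m≤n⇒m≤1+n (≤-trans (≼⇒≤ x≼pz) (parent< z))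

  ≼∧≥⇒≡ : ∀ {x y} → x ≼ y → y F.≤ x → x ≡ y
  ≼∧≥⇒≡ ≼-refl _ = refl
  ≼∧≥⇒≡ (≼-parent {z = z} x≼pz) z<x =
    contradiction (≤-trans (s≤s (≤-trans (≼⇒≤ x≼pz) (parent< z))) z<x) (<-irrefl refl)

  ≼-comparable : ∀ {x x′ y} → x ≼ y → x′ ≼ y → x ≼ x′ ⊎ x′ ≼ x
  ≼-comparable ≼-refl           x′≼y           = inj₂ x′≼y
  ≼-comparable (≼-parent x≼pz) ≼-refl          = inj₁ (≼-parent x≼pz)
  ≼-comparable (≼-parent x≼pz) (≼-parent x′≼pz) = ≼-comparable x≼pz x′≼pz

  walk-start : ∀ {S : Node → Set} {a b} → WalkIn TreeAdj S a b → S a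
  walk-start (here Sa)     = Sa
  walk-start (step Sa _ _) = Sa

  walk-commonAncestor : ∀ {S : Node → Set} {a b} → WalkIn TreeAdj S a b →
                        ∃ λ c → S c × c ≼ a × c ≼ b
  walk-commonAncestor (here Sa) = _ , Sa , ≼-refl , ≼-refl
  walk-commonAncestor (step _ (inj₁ (_ , refl , refl)) walk) with walk-commonAncestor walk
  ... | c , Sc , c≼a′ , c≼b = c , Sc , ≼-parent c≼a′ , c≼b
  walk-commonAncestor (step Sa (inj₂ (_ , refl , refl)) walk) with walk-commonAncestor walk
  ... | _ , _  , ≼-refl        , c≼b = _ , Sa , ≼-refl , ≼-trans (≼-parent ≼-refl) c≼b
  ... | c , Sc , ≼-parent c≼a , c≼b = c , Sc , c≼a , c≼b

  walk-through-ancestor : ∀ {S : Node → Set} {a b x} → WalkIn TreeAdj S a b → x ≼ b → x ≼ a ⊎ S x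
  walk-through-ancestor (here _) x≼b = inj₁ x≼b
  walk-through-ancestor (step _ adj walk) x≼b with walk-through-ancestor walk x≼b
  ... | inj₂ Sx  = inj₂ Sx
  ... | inj₁ x≼a′ = edge adj x≼a′ (walk-start walk)
    where
    edge : ∀ {S : Node → Set} {a a′ x} → TreeAdj a a′ → x ≼ a′ → S a′ → x ≼ a ⊎ S x
    edge (inj₁ (_ , refl , refl)) x≼a′          _    = inj₁ (≼-parent x≼a′)
    edge (inj₂ (_ , refl , refl)) ≼-refl         Sa′ = inj₂ Sa′
    edge (inj₂ (_ , refl , refl)) (≼-parent x≼a) _   = inj₁ x≼a

  leastBag : ∀ v → ∃ λ x → v ∈ₛ bag x × (∀ y → v ∈ₛ bag y → x F.≤ y)
  leastBag v = least (λ x → v ∈? bag x) (proj₂ (vertexIn v))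

  top : Fin m → Node
  top v = proj₁ (leastBag v)

  v∈bag-top : ∀ v → v ∈ₛ bag (top v)
  v∈bag-top v = proj₁ (proj₂ (leastBag v))

  top-≼ : ∀ {v y} → v ∈ₛ bag y → top v ≼ y
  top-≼ {v} {y} v∈y with walk-commonAncestor (connected v (top v) y (v∈bag-top v) v∈y)
  ... | c , v∈c , c≼top , c≼y with ≼∧≥⇒≡ c≼top (proj₂ (proj₂ (leastBag v)) c v∈c)
  ... | refl = c≼y

  -- Helly property of subtrees: the bag at the deepest top among the clique's vertices
  -- contains the whole clique.
  clique⊆bag : ∀ {K : Fin m → Set} → Decidable K → (∀ u v → K u → K v → u ≢ v → E u v) →
               ∃ λ x → ∀ u → K u → u ∈ₛ bag x
  clique⊆bag {K} K? clique with argmax K? (toℕ ∘ top)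
  ... | inj₁ none = zero , λ u Ku → contradiction Ku (none u)
  ... | inj₂ (v , Kv , deepest) = top v , inBag
    where
    inBag : ∀ u → K u → u ∈ₛ bag (top v)
    inBag u Ku with u F.≟ v
    ... | yes refl = v∈bag-top u
    ... | no u≢v with edgeIn u v (clique u v Ku Kv u≢v)
    ... | y , u∈y , v∈y with ≼-comparable (top-≼ v∈y) (top-≼ u∈y)
    ...   | inj₁ topv≼topu =
      subst (λ x → u ∈ₛ bag x) (sym (≼∧≥⇒≡ topv≼topu (deepest u Ku))) (v∈bag-top u)
    ...   | inj₂ topu≼topv with walk-through-ancestor (connected u (top u) y (v∈bag-top u) u∈y) (top-≼ v∈y)
    ...     | inj₂ u∈topv = u∈topv
    ...     | inj₁ topv≼topu = subst (λ x → u ∈ₛ bag x) (≼∧≥⇒≡ topu≼topv (≼⇒≤ topv≼topu)) (v∈bag-top u)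

  clique-size≤ : ∀ (f : Fin m → Bool) → (∀ u v → T (f u) → T (f v) → u ≢ v → E u v) → countB f ≤ suc w
  clique-size≤ f clique with clique⊆bag (λ u → T? (f u)) clique
  ... | x , f⊆x = ≤-trans (countB≤∣ bag x ∣ f⊆x) (bagSize x)

2*w+2≡suc[w]+suc[w] : ∀ w → 2 * w + 2 ≡ suc w + suc w
2*w+2≡suc[w]+suc[w] = solve-∀

nonZeros≤changes-inColumn :
  ∀ {m n w} (M M' : Matrix m n) → TreewidthAtMost M w → (∀ h → 2 * w + 2 ≤ clusterSize M' h) →
  ∀ j → countB (λ h → does (¬? (M h j ≟ 0))) ≤ countB (λ h → does (¬? (M h j ≟ M' h j)))
nonZeros≤changes-inColumn {m} {w = w} M M' td large j
  with any? (λ h → ¬? (M h j ≟ 0) ×-dec M h j ≟ M' h j)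
... | no noneKept = countB-mono _ _ λ h nz →
  T-does⁺ (¬? (M h j ≟ M' h j)) λ kept → noneKept (h , T-does⁻ (¬? (M h j ≟ 0)) nz , kept)
... | yes (h₀ , nz₀ , kept₀) = begin
  countB nonzero                                    ≤⟨ nonzero≤ ⟩
  suc w                                             ≤⟨ suc[w]≤zerosInCluster ⟩
  countB (λ h → inCluster h ∧ not (nonzero h))      ≤⟨ countB-mono _ _ zeroInCluster⇒changed ⟩
  countB (λ h → does (¬? (M h j ≟ M' h j)))         ∎
  where
  open ≤-Reasoning
  nonzero inCluster : Fin m → Bool
  nonzero h   = does (¬? (M h j ≟ 0))
  inCluster h = does (rowEq? M' h h₀)

  -- the rows with a one in column j form a clique of the primal graph
  nonzero≤ : countB nonzero ≤ suc w
  nonzero≤ = TreeDecompositionProperties.clique-size≤ td nonzero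
    λ u v nzu nzv u≢v → u≢v , j , T-does⁻ (¬? (M u j ≟ 0)) nzu , T-does⁻ (¬? (M v j ≟ 0)) nzv

  suc[w]≤zerosInCluster : suc w ≤ countB (λ h → inCluster h ∧ not (nonzero h))
  suc[w]≤zerosInCluster = +-cancelˡ-≤ (suc w) (suc w) _ (begin
    suc w + suc w                                   ≡⟨ 2*w+2≡suc[w]+suc[w] w ⟨
    2 * w + 2                                       ≤⟨ large h₀ ⟩
    countB inCluster                                ≡⟨ countB-split inCluster nonzero ⟩
    countB (λ h → inCluster h ∧ nonzero h) + _      ≤⟨ +-monoˡ-≤ _ (≤-trans nonzeroInCluster≤ nonzero≤) ⟩
    suc w + countB (λ h → inCluster h ∧ not (nonzero h)) ∎)
    where
    nonzeroInCluster≤ : countB (λ h → inCluster h ∧ nonzero h) ≤ countB nonzero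
    nonzeroInCluster≤ = countB-mono (λ h → inCluster h ∧ nonzero h) nonzero λ _ → proj₂ ∘ Equivalence.to T-∧

  zeroInCluster⇒changed : ∀ h → T (inCluster h ∧ not (nonzero h)) → T (does (¬? (M h j ≟ M' h j)))
  zeroInCluster⇒changed h t with Equivalence.to T-∧ t
  ... | sameRow , isZero = T-does⁺ (¬? (M h j ≟ M' h j)) λ kept →
    nz₀ (begin-equality
      M h₀ j     ≡⟨ kept₀ ⟩
      M' h₀ j    ≡⟨ T-does⁻ (rowEq? M' h h₀) sameRow j ⟨
      M' h j     ≡⟨ kept ⟨
      M h j      ≡⟨ T-does⁻ (M h j ≟ 0) (subst T (not-involutive _) isZero) ⟩
      0          ∎)

nonZeros≤distance : ∀ {m n w} (M M' : Matrix m n) → TreewidthAtMost M w →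
                    (∀ h → 2 * w + 2 ≤ clusterSize M' h) → nonZeros M ≤ distance M M'
nonZeros≤distance M M' td large =
  countB₂-mono-columnwise {f = λ i j → does (¬? (M i j ≟ 0))} {g = λ i j → does (¬? (M i j ≟ M' i j))}
    (nonZeros≤changes-inColumn M M' td large)

module _ {m n : ℕ} where

  0ᴹ : Matrix m n
  0ᴹ _ _ = 0

  0ᴹ-rowEq : (h h′ : Fin m) → does (rowEq? 0ᴹ h h′) ≡ true
  0ᴹ-rowEq h h′ = dec-true (rowEq? 0ᴹ h h′) λ _ → refl

  0ᴹ-fair : ∀ {c} (γ : Fin m → Fin c) → Fair 0ᴹ γ
  0ᴹ-fair γ h i = begin
    m * clusterColourSize 0ᴹ γ h i       ≡⟨ cong (m *_) (countB-cong λ h′ → cong (_∧ _) (0ᴹ-rowEq h′ h)) ⟩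
    m * colourCount γ i                  ≡⟨ *-comm m _ ⟩
    colourCount γ i * m                  ≡⟨ cong (colourCount γ i *_) m≡clusterSize ⟩
    colourCount γ i * clusterSize 0ᴹ h   ∎
    where
    open ≡-Reasoning
    m≡clusterSize : m ≡ clusterSize 0ᴹ h
    m≡clusterSize = trans (sym (countB-true m)) (countB-cong λ h′ → sym (0ᴹ-rowEq h′ h))

distinctRows-0ᴹ : ∀ {m n} → distinctRows (0ᴹ {m} {n}) ≤ 1
distinctRows-0ᴹ {zero}      = z≤n
distinctRows-0ᴹ {suc m} {n} =
  ≤-trans (countB≤∣_∣ {f = does ∘ new?} ⁅ zero ⁆ onlyFirst) (≤-reflexive (∣⁅x⁆∣≡1 (zero {m})))
  where
  new? : (h : Fin (suc m)) → Dec (∀ h′ → ¬ (h′ F.< h × RowEq (0ᴹ {n = n}) h′ h))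
  new? h = all? λ h′ → ¬? (h′ F.<? h ×-dec rowEq? (0ᴹ {n = n}) h′ h)

  onlyFirst : (h : Fin (suc m)) → T (does (new? h)) → h ∈ₛ ⁅ zero ⁆
  onlyFirst zero    _     = x∈⁅x⁆ zero
  onlyFirst (suc h) isNew = contradiction (s≤s z≤n , λ _ → refl) (T-does⁻ (new? (suc h)) isNew zero)

lemma12 : ∀ {m n c : ℕ} (M : Matrix m n) (γ : Fin m → Fin c) (k r : ℕ) →
          1 ≤ k → 1 ≤ r → Binary M →
          (∃ λ w → TreewidthAtMost M w × 2 * w + 2 ≤ fairletSize γ) →
          (YesFDMC M γ r k ⇔ nonZeros M ≤ k)
lemma12 {m} {n} M γ k r _ 1≤r _ (w , td , 2w+2≤c̃) = mk⇔ solution⇒ ⇒solution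
  where
  solution⇒ : YesFDMC M γ r k → nonZeros M ≤ k
  solution⇒ (M' , fair , dist≤k , _) =
    ≤-trans (nonZeros≤distance M M' td λ h → ≤-trans 2w+2≤c̃ (fairletSize≤clusterSize M' γ fair h)) dist≤k

  ⇒solution : nonZeros M ≤ k → YesFDMC M γ r k
  ⇒solution nonZeros≤k = 0ᴹ , 0ᴹ-fair {n = n} γ , nonZeros≤k , ≤-trans (distinctRows-0ᴹ {m} {n}) 1≤r
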